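{- Let $n,m,d$ be positive integers with $n=dm$ and $\gcd(d,m)=1$, and let $r,t\in \mathbb{Z}$ with $\gcd(r,n)=1$. Then \[ \kappa(n,r,t)=\frac{|r|_n\,\kappa(d,r,t)\,\kappa(m,r,t)}{\gcd\left(\kappa(d,r,t),|r|_n\right)\gcd\left(\kappa(m,r,t),|r|_n\right)}. \] In particular, $\kappa(d,r,t)$ is a divisor of $\kappa(n,r,t)$.
   Context: $|r|_m$ is the multiplicative order of $r$ modulo $m$ (for $\gcd(r,m)=1$). $S_k(x)=1+x+\cdots+x^{k-1}$ for $k\ge1$, $S_0(x)=0$. For a positive integer $N$ and $\gcd(r,N)=1$, $\kappa(N,r,t)=\dfrac{N|r|_N}{\gcd(N,\ tS_{|r|_N}(r))}$. -}

module Defs where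

open import Data.Nat as ℕ using (ℕ; zero; suc; NonZero; ≢-nonZero)
open import Data.Nat.GCD using (gcd; gcd[m,n]≢0)
open import Data.Integer as ℤ using (ℤ; +_; ∣_∣)
open import Data.Integer.Divisibility as ℤD using ()
open import Data.Sum using (inj₁)
open import Data.Product using (_×_)
open import Relation.Nullary using (¬_)

S : ℕ → ℤ → ℤ
S zero    x = + 0
S (suc k) x = S k x ℤ.+ x ℤ.^ k

IsMultOrder : ℤ → ℕ → ℕ → Set
IsMultOrder r N k =
  (1 ℕ.≤ k) ×
  ((+ N) ℤD.∣ (r ℤ.^ k ℤ.- + 1)) ×
  (∀ j → 1 ℕ.≤ j → j ℕ.< k → ¬ ((+ N) ℤD.∣ (r ℤ.^ j ℤ.- + 1)))

-- κ(N, r, t) = N |r|_N / gcd(N, t S_{|r|_N}(r)), where the order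
-- k = |r|_N is supplied as an argument (it is pinned down by IsMultOrder
-- in the statement).
κ : (N : ℕ) → .{{NonZero N}} → (k : ℕ) → ℤ → ℤ → ℕ
κ N@(suc _) k r t =
  ℕ._/_ (N ℕ.* k) (gcd N ∣ t ℤ.* S k r ∣)
    {{≢-nonZero (gcd[m,n]≢0 N ∣ t ℤ.* S k r ∣ (inj₁ λ ()))}}

{-# OPTIONS --safe #-}
-- Write cof(N, x) = N / gcd(N, x), so that κ N k r t = cof(N, |t S_k(r)|) k. Let k = |r|_n and
-- D ∈ {d, m} with a = |r|_D. Then a ∣ k, say k = c a, and S_k(r) ≡ c S_a(r) (mod D) since
-- r^a ≡ 1 (mod D). With D = D′ g and g = gcd(D, t S_a(r)), the cofactor D′ is coprime to
-- t S_a(r) / g, so gcd(D, t S_k(r)) = g gcd(D′, c); consequently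
-- cof(D, t S_k(r)) gcd(κ(D, r, t), k) = κ(D, r, t). As cof(-, x) is multiplicative on coprime
-- arguments, κ(n, r, t) = cof(d, X) cof(m, X) k for X = t S_k(r), and both claims follow by
-- multiplying out.
module Submission where

open import Defs
open import Data.Nat using (ℕ; NonZero; _*_; _+_; _<_; zero; suc; s≤s; z≤n; _%_; _/_; >-nonZero; ≢-nonZero; ≢-nonZero⁻¹)
open import Data.Nat.Properties using (+-identityʳ; +-suc; *-assoc; *-comm; *-cancelʳ-≡; m*n≢0; *-commutativeSemigroup)
open import Data.Nat.Divisibility using (_∣_; divides; quotient; _∣0; ∣-antisym; ∣-trans; ∣m⇒∣m*n; ∣n⇒∣m*n; *-monoʳ-∣; *-pres-∣; m∣n⇒n≡quotient*m; m∣n⇒n≡m*quotient; n/m≡quotient; m%n≡0⇒n∣m; module ∣-Reasoning)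
open import Data.Nat.DivMod using (m≡m%n+[m/n]*n; m%n<n; /-congˡ; m*n/n≡m)
open import Data.Nat.GCD using (gcd; gcd[m,n]∣m; gcd[m,n]∣n; gcd-greatest; gcd[m,n]≢0; c*gcd[m,n]≡gcd[cm,cn])
open import Data.Nat.Coprimality using (Coprime; coprime-divisor; coprime-/gcd) renaming (sym to coprime-sym)
open import Data.Nat.Tactic.RingSolver using () renaming (solve-∀ to ℕ-solve-∀)
open import Data.Integer as ℤ using (ℤ; +_; ∣_∣)
open import Data.Integer.Properties as ℤ using (^-distribˡ-+-*; ^-*-assoc; abs-*)
open import Data.Integer.Divisibility.Signed as ℤ using (∣ᵤ⇒∣; ∣⇒∣ᵤ) renaming (_∣_ to _∣ℤ_)
open import Data.Integer.Tactic.RingSolver using (solve-∀)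
open import Algebra.Properties.CommutativeSemigroup *-commutativeSemigroup using (x∙yz≈y∙xz; xy∙z≈xz∙y; xy∙z≈x∙zy; interchange)
open import Data.Empty using (⊥-elim)
open import Data.Sum using (inj₁)
open import Data.Product using (_×_; _,_)
open import Relation.Binary.PropositionalEquality using (_≡_; refl; sym; trans; cong; cong₂; subst; subst₂; module ≡-Reasoning)

infix 4 _≡_mod_

_≡_mod_ : ℤ → ℤ → ℕ → Set
x ≡ y mod N = + N ∣ℤ x ℤ.- y

≡-mod-∣ : ∀ {x y D N} → D ∣ N → x ≡ y mod N → x ≡ y mod D
≡-mod-∣ {D = D} {N} D∣N = ℤ.∣-trans (∣ᵤ⇒∣ {+ D} {+ N} D∣N)

≡-mod-sym : ∀ {x y N} → x ≡ y mod N → y ≡ x mod N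
≡-mod-sym {x} {y} x≡y = subst (_ ∣ℤ_) (-[x-y]≡y-x x y) (ℤ.∣m⇒∣-m x≡y)
  where
  -[x-y]≡y-x : ∀ x y → ℤ.- (x ℤ.- y) ≡ y ℤ.- x
  -[x-y]≡y-x = solve-∀

[xy-1]≡x[y-1]+[x-1] : ∀ x y → x ℤ.* y ℤ.- + 1 ≡ x ℤ.* (y ℤ.- + 1) ℤ.+ (x ℤ.- + 1)
[xy-1]≡x[y-1]+[x-1] = solve-∀

x≡1⇒x^n≡1 : ∀ {x N} → x ≡ + 1 mod N → ∀ n → x ℤ.^ n ≡ + 1 mod N
x≡1⇒x^n≡1 x≡1 zero = ∣ᵤ⇒∣ (_ ∣0)
x≡1⇒x^n≡1 {x} x≡1 (suc n) = subst (_ ∣ℤ_) (sym ([xy-1]≡x[y-1]+[x-1] x (x ℤ.^ n)))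
  (ℤ.∣m∣n⇒∣m+n (ℤ.∣n⇒∣m*n x (x≡1⇒x^n≡1 x≡1 n)) x≡1)

order∣ : ∀ {r D a k} → IsMultOrder r D a → r ℤ.^ k ≡ + 1 mod D → a ∣ k
order∣ {r} {D} {a} {k} (a≥1 , r^a≡1 , minimal) r^k≡1 =
  m%n≡0⇒n∣m k a (remainder≡0 (k % a) (m%n<n k a) r^ρ≡1)
  where
  instance
    a≢0 : NonZero a
    a≢0 = >-nonZero a≥1
  ρ : ℕ
  ρ = k % a
  y : ℤ
  y = (r ℤ.^ a) ℤ.^ (k / a)
  r^k≡r^ρ*y : r ℤ.^ k ≡ r ℤ.^ ρ ℤ.* y
  r^k≡r^ρ*y = begin
    r ℤ.^ k                          ≡⟨ cong (r ℤ.^_) (m≡m%n+[m/n]*n k a) ⟩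
    r ℤ.^ (ρ + k / a * a)            ≡⟨ ^-distribˡ-+-* r ρ (k / a * a) ⟩
    r ℤ.^ ρ ℤ.* r ℤ.^ (k / a * a)    ≡⟨ cong (λ e → r ℤ.^ ρ ℤ.* r ℤ.^ e) (*-comm (k / a) a) ⟩
    r ℤ.^ ρ ℤ.* r ℤ.^ (a * (k / a))  ≡⟨ cong (r ℤ.^ ρ ℤ.*_) (^-*-assoc r a (k / a)) ⟨
    r ℤ.^ ρ ℤ.* y                    ∎
    where open ≡-Reasoning
  r^ρ≡1 : r ℤ.^ ρ ≡ + 1 mod D
  r^ρ≡1 = ℤ.∣m+n∣m⇒∣n
    (subst (_ ∣ℤ_) ([xy-1]≡x[y-1]+[x-1] (r ℤ.^ ρ) y) (subst (λ z → z ≡ + 1 mod D) r^k≡r^ρ*y r^k≡1))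
    (ℤ.∣n⇒∣m*n (r ℤ.^ ρ) (x≡1⇒x^n≡1 (∣ᵤ⇒∣ r^a≡1) (k / a)))
  remainder≡0 : ∀ j → j < a → r ℤ.^ j ≡ + 1 mod D → j ≡ 0
  remainder≡0 zero    _   _      = refl
  remainder≡0 (suc j) j<a r^j≡1 = ⊥-elim (minimal (suc j) (s≤s z≤n) j<a (∣⇒∣ᵤ r^j≡1))

S-+ : ∀ p q x → S (p + q) x ≡ S p x ℤ.+ x ℤ.^ p ℤ.* S q x
S-+ p zero x = begin
  S (p + 0) x                  ≡⟨ cong (λ k → S k x) (+-identityʳ p) ⟩
  S p x                        ≡⟨ ℤ.+-identityʳ (S p x) ⟨
  S p x ℤ.+ + 0                ≡⟨ cong (ℤ._+_ (S p x)) (ℤ.*-zeroʳ (x ℤ.^ p)) ⟨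
  S p x ℤ.+ x ℤ.^ p ℤ.* + 0    ∎
  where open ≡-Reasoning
S-+ p (suc q) x = begin
  S (p + suc q) x                                        ≡⟨ cong (λ k → S k x) (+-suc p q) ⟩
  S (p + q) x ℤ.+ x ℤ.^ (p + q)                          ≡⟨ cong₂ ℤ._+_ (S-+ p q x) (^-distribˡ-+-* x p q) ⟩
  S p x ℤ.+ x ℤ.^ p ℤ.* S q x ℤ.+ x ℤ.^ p ℤ.* x ℤ.^ q    ≡⟨ ℤ.+-assoc (S p x) _ _ ⟩
  S p x ℤ.+ (x ℤ.^ p ℤ.* S q x ℤ.+ x ℤ.^ p ℤ.* x ℤ.^ q)
    ≡⟨ cong (ℤ._+_ (S p x)) (ℤ.*-distribˡ-+ (x ℤ.^ p) (S q x) (x ℤ.^ q)) ⟨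
  S p x ℤ.+ x ℤ.^ p ℤ.* S (suc q) x                      ∎
  where open ≡-Reasoning

S[c*a]≡c*S[a] : ∀ {N} r a → r ℤ.^ a ≡ + 1 mod N → ∀ c → S (c * a) r ≡ + c ℤ.* S a r mod N
S[c*a]≡c*S[a] r a r^a≡1 zero = ∣ᵤ⇒∣ (_ ∣0)
S[c*a]≡c*S[a] r a r^a≡1 (suc c) =
  subst (_ ∣ℤ_) (sym (trans (cong (λ s → s ℤ.- + suc c ℤ.* S a r) (S-+ a (c * a) r))
                            (regroup (S a r) (r ℤ.^ a) (S (c * a) r) (+ c))))
    (ℤ.∣m∣n⇒∣m+n (ℤ.∣n⇒∣m*n (S (c * a) r) r^a≡1) (S[c*a]≡c*S[a] r a r^a≡1 c))
  where
  regroup : ∀ Sa A T C →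
            Sa ℤ.+ A ℤ.* T ℤ.- (+ 1 ℤ.+ C) ℤ.* Sa ≡ T ℤ.* (A ℤ.- + 1) ℤ.+ (T ℤ.- C ℤ.* Sa)
  regroup = solve-∀

gcd-cong : ∀ {N} x y → x ≡ y mod N → gcd N ∣ x ∣ ≡ gcd N ∣ y ∣
gcd-cong {N} x y x≡y = ∣-antisym
  (gcd-greatest (gcd[m,n]∣m N ∣ x ∣) (gcd[N,x]∣y x y x≡y))
  (gcd-greatest (gcd[m,n]∣m N ∣ y ∣) (gcd[N,x]∣y y x (≡-mod-sym {x} {y} x≡y)))
  where
  x-[x-y]≡y : ∀ x y → x ℤ.- (x ℤ.- y) ≡ y
  x-[x-y]≡y = solve-∀
  gcd[N,x]∣y : ∀ x y → x ≡ y mod N → gcd N ∣ x ∣ ∣ ∣ y ∣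
  gcd[N,x]∣y x y x≡y = ∣⇒∣ᵤ (subst (g ∣ℤ_) (x-[x-y]≡y x y) (ℤ.∣m∣n⇒∣m-n g∣x g∣x-y))
    where
    g : ℤ
    g = + gcd N ∣ x ∣
    g∣x : g ∣ℤ x
    g∣x = ∣ᵤ⇒∣ (gcd[m,n]∣n N ∣ x ∣)
    g∣x-y : g ∣ℤ x ℤ.- y
    g∣x-y = ℤ.∣-trans (∣ᵤ⇒∣ (gcd[m,n]∣m N ∣ x ∣)) x≡y

gcd-nonZeroˡ : ∀ m n .{{_ : NonZero m}} → NonZero (gcd m n)
gcd-nonZeroˡ m n = ≢-nonZero (gcd[m,n]≢0 m n (inj₁ (≢-nonZero⁻¹ m)))

coprime-*-∣ : ∀ {m n o} → Coprime m n → m ∣ o → n ∣ o → m * n ∣ o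
coprime-*-∣ {m} {n} {o} m⊥n (divides q o≡q*m) n∣o = subst (m * n ∣_) (sym o≡m*q) (*-monoʳ-∣ m n∣q)
  where
  o≡m*q : o ≡ m * q
  o≡m*q = trans o≡q*m (*-comm q m)
  n∣q : n ∣ q
  n∣q = coprime-divisor (coprime-sym m⊥n) (subst (n ∣_) o≡m*q n∣o)

gcd[m*o,n*o]≡gcd[m,n]*o : ∀ m n o → gcd (m * o) (n * o) ≡ gcd m n * o
gcd[m*o,n*o]≡gcd[m,n]*o m n o = begin
  gcd (m * o) (n * o)   ≡⟨ cong₂ gcd (*-comm m o) (*-comm n o) ⟩
  gcd (o * m) (o * n)   ≡⟨ c*gcd[m,n]≡gcd[cm,cn] o m n ⟨
  o * gcd m n           ≡⟨ *-comm o (gcd m n) ⟩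
  gcd m n * o           ∎
  where open ≡-Reasoning

coprime⇒gcd[m*n,o]≡gcd[m,o]*gcd[n,o] : ∀ {m n} o → Coprime m n → gcd (m * n) o ≡ gcd m o * gcd n o
coprime⇒gcd[m*n,o]≡gcd[m,o]*gcd[n,o] {m} {n} o m⊥n = ∣-antisym G∣gm*gn gm*gn∣G
  where
  G gm gn : ℕ
  G  = gcd (m * n) o
  gm = gcd m o
  gn = gcd n o
  gm⊥gn : Coprime gm gn
  gm⊥gn (i∣gm , i∣gn) = m⊥n (∣-trans i∣gm (gcd[m,n]∣m m o) , ∣-trans i∣gn (gcd[m,n]∣m n o))
  gm*gn∣G : gm * gn ∣ G
  gm*gn∣G = gcd-greatest (*-pres-∣ (gcd[m,n]∣m m o) (gcd[m,n]∣m n o))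
                         (coprime-*-∣ gm⊥gn (gcd[m,n]∣n m o) (gcd[m,n]∣n n o))
  G∣m*gn : G ∣ m * gn
  G∣m*gn = subst (G ∣_) (sym (c*gcd[m,n]≡gcd[cm,cn] m n o))
    (gcd-greatest (gcd[m,n]∣m (m * n) o) (∣n⇒∣m*n m (gcd[m,n]∣n (m * n) o)))
  G∣o*gn : G ∣ o * gn
  G∣o*gn = subst (G ∣_) (sym (c*gcd[m,n]≡gcd[cm,cn] o n o))
    (gcd-greatest (∣m⇒∣m*n n (gcd[m,n]∣n (m * n) o)) (∣n⇒∣m*n o (gcd[m,n]∣n (m * n) o)))
  G∣gm*gn : G ∣ gm * gn
  G∣gm*gn = subst (G ∣_) (gcd[m*o,n*o]≡gcd[m,n]*o m o gn) (gcd-greatest G∣m*gn G∣o*gn)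

coprime⇒gcd[m,o*n]≡gcd[m,o] : ∀ {m n} o → Coprime m n → gcd m (o * n) ≡ gcd m o
coprime⇒gcd[m,o*n]≡gcd[m,o] {m} {n} o m⊥n = ∣-antisym
  (gcd-greatest (gcd[m,n]∣m m (o * n)) (coprime-divisor G⊥n G∣n*o))
  (gcd-greatest (gcd[m,n]∣m m o) (∣m⇒∣m*n n (gcd[m,n]∣n m o)))
  where
  G : ℕ
  G = gcd m (o * n)
  G⊥n : Coprime G n
  G⊥n (i∣G , i∣n) = m⊥n (∣-trans i∣G (gcd[m,n]∣m m (o * n)) , i∣n)
  G∣n*o : G ∣ n * o
  G∣n*o = subst (G ∣_) (*-comm o n) (gcd[m,n]∣n m (o * n))

-- N / gcd N x, read off the divisibility gcd N x ∣ N so that no NonZero instance is needed.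
cofactor : ℕ → ℕ → ℕ
cofactor N x = quotient (gcd[m,n]∣m N x)

cofactor-unique : ∀ {N x q} .{{_ : NonZero N}} → N ≡ q * gcd N x → cofactor N x ≡ q
cofactor-unique {N} {x} {q} N≡q*g = *-cancelʳ-≡ (cofactor N x) q (gcd N x) {{gcd-nonZeroˡ N x}}
  (trans (sym (m∣n⇒n≡quotient*m (gcd[m,n]∣m N x))) N≡q*g)

cofactor-* : ∀ {m n} x .{{_ : NonZero m}} .{{_ : NonZero n}} → Coprime m n →
             cofactor (m * n) x ≡ cofactor m x * cofactor n x
cofactor-* {m} {n} x m⊥n = cofactor-unique {{m*n≢0 m n}} (begin
  m * n                                  ≡⟨ cong₂ _*_ (m∣n⇒n≡quotient*m (gcd[m,n]∣m m x))
                                                      (m∣n⇒n≡quotient*m (gcd[m,n]∣m n x)) ⟩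
  cm * gcd m x * (cn * gcd n x)          ≡⟨ interchange cm (gcd m x) cn (gcd n x) ⟩
  cm * cn * (gcd m x * gcd n x)          ≡⟨ cong (cm * cn *_) (coprime⇒gcd[m*n,o]≡gcd[m,o]*gcd[n,o] x m⊥n) ⟨
  cm * cn * gcd (m * n) x                ∎)
  where
  open ≡-Reasoning
  cm cn : ℕ
  cm = cofactor m x
  cn = cofactor n x

gcd-*-cofactor : ∀ N x c .{{_ : NonZero N}} → gcd N (c * x) ≡ gcd N x * gcd (cofactor N x) c
gcd-*-cofactor N x c = begin
  gcd N (c * x)              ≡⟨ cong₂ gcd (m∣n⇒n≡m*quotient (gcd[m,n]∣m N x)) c*x≡g*[c*x′] ⟩
  gcd (g * N′) (g * (c * x′)) ≡⟨ c*gcd[m,n]≡gcd[cm,cn] g N′ (c * x′) ⟨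
  g * gcd N′ (c * x′)        ≡⟨ cong (g *_) (coprime⇒gcd[m,o*n]≡gcd[m,o] c N′⊥x′) ⟩
  g * gcd N′ c               ∎
  where
  open ≡-Reasoning
  g N′ x′ : ℕ
  g  = gcd N x
  N′ = cofactor N x
  x′ = quotient (gcd[m,n]∣n N x)
  instance
    g≢0 : NonZero g
    g≢0 = gcd-nonZeroˡ N x
  c*x≡g*[c*x′] : c * x ≡ g * (c * x′)
  c*x≡g*[c*x′] = trans (cong (c *_) (m∣n⇒n≡m*quotient (gcd[m,n]∣n N x))) (x∙yz≈y∙xz c g x′)
  N′⊥x′ : Coprime N′ x′
  N′⊥x′ = subst₂ Coprime (n/m≡quotient (gcd[m,n]∣m N x)) (n/m≡quotient (gcd[m,n]∣n N x))
                 (coprime-/gcd N x)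

κ≡cofactor*k : ∀ N .{{_ : NonZero N}} k r t → κ N k r t ≡ cofactor N ∣ t ℤ.* S k r ∣ * k
κ≡cofactor*k N@(suc _) k r t = begin
  N * k / g                ≡⟨ /-congˡ (cong (_* k) (m∣n⇒n≡quotient*m (gcd[m,n]∣m N X))) ⟩
  cofactor N X * g * k / g ≡⟨ /-congˡ (xy∙z≈xz∙y (cofactor N X) g k) ⟩
  cofactor N X * k * g / g ≡⟨ m*n/n≡m (cofactor N X * k) g ⟩
  cofactor N X * k         ∎
  where
  open ≡-Reasoning
  X g : ℕ
  X = ∣ t ℤ.* S k r ∣
  g = gcd N X
  instance
    g≢0 : NonZero g
    g≢0 = gcd-nonZeroˡ N X

gcd[N,tS[c*a]] : ∀ {N} r a t .{{_ : NonZero N}} → r ℤ.^ a ≡ + 1 mod N → ∀ c →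
                 gcd N ∣ t ℤ.* S (c * a) r ∣ ≡ gcd N ∣ t ℤ.* S a r ∣ * gcd (cofactor N ∣ t ℤ.* S a r ∣) c
gcd[N,tS[c*a]] {N} r a t r^a≡1 c = begin
  gcd N ∣ t ℤ.* S (c * a) r ∣       ≡⟨ gcd-cong (t ℤ.* S (c * a) r) (+ c ℤ.* (t ℤ.* S a r)) tS[c*a]≡c*tS[a] ⟩
  gcd N ∣ + c ℤ.* (t ℤ.* S a r) ∣   ≡⟨ cong (gcd N) (abs-* (+ c) (t ℤ.* S a r)) ⟩
  gcd N (c * ∣ t ℤ.* S a r ∣)       ≡⟨ gcd-*-cofactor N ∣ t ℤ.* S a r ∣ c ⟩
  gcd N ∣ t ℤ.* S a r ∣ * gcd (cofactor N ∣ t ℤ.* S a r ∣) c ∎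
  where
  open ≡-Reasoning
  factor-t : ∀ t U C V → t ℤ.* U ℤ.- C ℤ.* (t ℤ.* V) ≡ t ℤ.* (U ℤ.- C ℤ.* V)
  factor-t = solve-∀
  tS[c*a]≡c*tS[a] : t ℤ.* S (c * a) r ≡ + c ℤ.* (t ℤ.* S a r) mod N
  tS[c*a]≡c*tS[a] = subst (_ ∣ℤ_) (sym (factor-t t (S (c * a) r) (+ c) (S a r)))
                          (ℤ.∣n⇒∣m*n t (S[c*a]≡c*S[a] r a r^a≡1 c))

κ≡cofactor*gcd[κ,k] : ∀ {D r a k} t .{{_ : NonZero D}} → IsMultOrder r D a → r ℤ.^ k ≡ + 1 mod D →
                      κ D a r t ≡ cofactor D ∣ t ℤ.* S k r ∣ * gcd (κ D a r t) k
κ≡cofactor*gcd[κ,k] {D} {r} {a} {k} t order@(_ , r^a≡1 , _) r^k≡1 with order∣ {k = k} order r^k≡1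
... | divides c refl = begin
  κ D a r t                                 ≡⟨ κ≡cofactor*k D a r t ⟩
  D′ * a                                    ≡⟨ cong (_* a) D′≡q*h ⟩
  q * h * a                                 ≡⟨ *-assoc q h a ⟩
  q * (h * a)                               ≡⟨ cong₂ _*_ cofactor≡q gcd[κ,c*a]≡h*a ⟨
  cofactor D ∣ t ℤ.* S (c * a) r ∣ * gcd (κ D a r t) (c * a) ∎
  where
  open ≡-Reasoning
  g D′ h q : ℕ
  g  = gcd D ∣ t ℤ.* S a r ∣
  D′ = cofactor D ∣ t ℤ.* S a r ∣
  h  = gcd D′ c
  q  = quotient (gcd[m,n]∣m D′ c)
  D′≡q*h : D′ ≡ q * h
  D′≡q*h = m∣n⇒n≡quotient*m (gcd[m,n]∣m D′ c)
  cofactor≡q : cofactor D ∣ t ℤ.* S (c * a) r ∣ ≡ q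
  cofactor≡q = cofactor-unique (begin
    D                                 ≡⟨ m∣n⇒n≡quotient*m (gcd[m,n]∣m D ∣ t ℤ.* S a r ∣) ⟩
    D′ * g                            ≡⟨ cong (_* g) D′≡q*h ⟩
    q * h * g                         ≡⟨ xy∙z≈x∙zy q h g ⟩
    q * (g * h)                       ≡⟨ cong (q *_) (gcd[N,tS[c*a]] r a t (∣ᵤ⇒∣ r^a≡1) c) ⟨
    q * gcd D ∣ t ℤ.* S (c * a) r ∣   ∎)
  gcd[κ,c*a]≡h*a : gcd (κ D a r t) (c * a) ≡ h * a
  gcd[κ,c*a]≡h*a = trans (cong (λ z → gcd z (c * a)) (κ≡cofactor*k D a r t))
                         (gcd[m*o,n*o]≡gcd[m,n]*o D′ c a)

κ≡cofactor*cofactor*k : ∀ {n d m} k r t .{{_ : NonZero n}} .{{_ : NonZero d}} .{{_ : NonZero m}} →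
                        n ≡ d * m → Coprime d m →
                        κ n k r t ≡ cofactor d ∣ t ℤ.* S k r ∣ * cofactor m ∣ t ℤ.* S k r ∣ * k
κ≡cofactor*cofactor*k {n} {d} {m} k r t n≡dm d⊥m = begin
  κ n k r t                          ≡⟨ κ≡cofactor*k n k r t ⟩
  cofactor n X * k                   ≡⟨ cong (λ N → cofactor N X * k) n≡dm ⟩
  cofactor (d * m) X * k             ≡⟨ cong (_* k) (cofactor-* X d⊥m) ⟩
  cofactor d X * cofactor m X * k    ∎
  where
  open ≡-Reasoning
  X : ℕ
  X = ∣ t ℤ.* S k r ∣

lemma3p3 : (n m d : ℕ) → .{{_ : NonZero n}} → .{{_ : NonZero m}} → .{{_ : NonZero d}} →
    n ≡ d * m → Coprime d m →
    (r t : ℤ) → Coprime ∣ r ∣ n →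
    (on om od : ℕ) → IsMultOrder r n on → IsMultOrder r m om → IsMultOrder r d od →
    (κ n on r t * (gcd (κ d od r t) on * gcd (κ m om r t) on) ≡ on * κ d od r t * κ m om r t)
    × (κ d od r t ∣ κ n on r t)
lemma3p3 n m d n≡dm d⊥m r t _ k b a (_ , n∣r^k-1 , _) m-order d-order = κ-identity , κd∣κn
  where
  cd cm gd gm : ℕ
  cd = cofactor d ∣ t ℤ.* S k r ∣
  cm = cofactor m ∣ t ℤ.* S k r ∣
  gd = gcd (κ d a r t) k
  gm = gcd (κ m b r t) k
  r^k≡1 : ∀ {D} → D ∣ n → r ℤ.^ k ≡ + 1 mod D
  r^k≡1 D∣n = ≡-mod-∣ {r ℤ.^ k} {+ 1} D∣n (∣ᵤ⇒∣ n∣r^k-1)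
  κn≡cd*cm*k : κ n k r t ≡ cd * cm * k
  κn≡cd*cm*k = κ≡cofactor*cofactor*k k r t n≡dm d⊥m
  κd≡cd*gd : κ d a r t ≡ cd * gd
  κd≡cd*gd = κ≡cofactor*gcd[κ,k] t d-order (r^k≡1 (divides m (trans n≡dm (*-comm d m))))
  κm≡cm*gm : κ m b r t ≡ cm * gm
  κm≡cm*gm = κ≡cofactor*gcd[κ,k] t m-order (r^k≡1 (divides d n≡dm))
  regroup : ∀ cd cm k gd gm → cd * cm * k * (gd * gm) ≡ k * (cd * gd) * (cm * gm)
  regroup = ℕ-solve-∀
  κ-identity : κ n k r t * (gd * gm) ≡ k * κ d a r t * κ m b r t
  κ-identity = begin
    κ n k r t * (gd * gm)        ≡⟨ cong (_* (gd * gm)) κn≡cd*cm*k ⟩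
    cd * cm * k * (gd * gm)      ≡⟨ regroup cd cm k gd gm ⟩
    k * (cd * gd) * (cm * gm)    ≡⟨ cong₂ (λ u v → k * u * v) κd≡cd*gd κm≡cm*gm ⟨
    k * κ d a r t * κ m b r t    ∎
    where open ≡-Reasoning
  κd∣κn : κ d a r t ∣ κ n k r t
  κd∣κn = begin
    κ d a r t      ≡⟨ κd≡cd*gd ⟩
    cd * gd        ∣⟨ *-monoʳ-∣ cd (∣n⇒∣m*n cm (gcd[m,n]∣n (κ d a r t) k)) ⟩
    cd * (cm * k)  ≡⟨ *-assoc cd cm k ⟨
    cd * cm * k    ≡⟨ κn≡cd*cm*k ⟨
    κ n k r t      ∎
    where open ∣-Reasoning
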